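{- Let $\mathcal{P}=(\mathcal{E},D,c,f_c)$ be a combinatorial sum problem and $E=\{e_1,e_2,\dots,e_k\}\subseteq\mathcal{E}$. Then the optimal objective value of the following linear program (ELL) in the variables $\alpha_1,\dots,\alpha_k$ is equal to the set lower tolerance $l'_{\mathcal{P}}(E)$: maximize $\sum_{i=1}^k\alpha_i$ subject to $\sum_{i:\,e_i\in F}\alpha_i\le f_c(D_{\sim}(E\setminus F;F))-c^\ast$ for all $F\subseteq E$, and $\alpha_i\ge0$ for all $i\in[k]$.
   Context: A combinatorial sum problem (CSP) is a tuple $\mathcal{P}=(\mathcal{E},D,c,f_c)$, where $\mathcal{E}$ is a finite ground set, $D\subseteq 2^{\mathcal{E}}\setminus\{\emptyset\}$ is the set of feasible solutions, $c:\mathcal{E}\to\mathbb{R}$ and $f_c(S)=\sum_{e\in S}c(e)$ for $S\in D$. For $M\subseteq D$, $f_c(M)=\min_{S\in M}f_c(S)$, with $f_c(\emptyset)=\infty$; $c^\ast=f_c(D)$. For $A,B\subseteq\mathcal{E}$: $D_{\sim}(A;B)=\{S\in D: A\cap S=\emptyset,\ B\subseteq S\}$. $[k]=\{1,\dots,k\}$. For $E=\{e_1,\dots,e_k\}$ and $\vec\alpha=(\alpha_1,\dots,\alpha_k)\in\mathbb{R}^k$, $\mathcal{P}_{c_{ -\vec\alpha,E}}$ is the CSP with the same $\mathcal{E},D$ and cost function $c_{ -\vec\alpha,E}$ with $c_{ -\vec\alpha,E}(e_i)=c(e_i)-\alpha_i$ and $c_{ -\vec\alpha,E}(e)=c(e)$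 for $e\notin E$; $f_{c_{ -\vec\alpha,E}}(\mathcal{P}_{c_{ -\vec\alpha,E}})$ denotes its optimal value. The set lower tolerance is $l'_{\mathcal{P}}(E)=\max\{\alpha\in\mathbb{R}:$ there exists $\vec\alpha=(\alpha_1,\dots,\alpha_k)$ with all $\alpha_i\ge0$, $\alpha=\sum_i\alpha_i$, $f_{c_{ -\vec\alpha,E}}(\mathcal{P}_{c_{ -\vec\alpha,E}})=c^\ast\}$, with value $\infty$ if this set is unbounded. In the linear program, constraints with infinite right-hand side are dropped, and its optimal value is $\infty$ if it is unbounded. -}

module Defs where

open import Level using (0ℓ)
open import Data.Nat using (ℕ; zero; suc)
open import Data.Fin using (Fin; zero; suc)
open import Data.Fin.Properties using (any?) renaming (_≟_ to _≟ᶠ_)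
open import Data.Fin.Subset using (Subset; _∈_; _⊆_; _∩_; _─_; ⊥)
open import Data.Fin.Subset.Properties using (_∈?_; _⊆?_)
open import Data.Bool using (Bool; true; false; if_then_else_)
open import Data.Vec using (tabulate)
open import Data.Vec.Properties using (≡-dec)
import Data.Bool.Properties as BoolP
open import Data.List using (List; []; _∷_; filter)
open import Data.Product using (Σ; _×_; _,_)
open import Data.Unit using (⊤)
open import Relation.Nullary using (¬_; does)
open import Relation.Nullary.Decidable using (_×-dec_)
open import Relation.Binary.PropositionalEquality using (_≡_; _≢_)
open import Relation.Binary.Structures using (IsDecTotalOrder)
open import Algebra.Structures using (IsCommutativeRing)

-- Ordered fields (the paper works over ℝ; we work over an arbitrary
-- ordered field, ℝ being one instance).  Equality is propositional.

record OrderedField : Set₁ where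
  infixl 6 _+_
  infixl 7 _*_
  infix  8 -_
  infix  4 _≤_
  field
    Carrier : Set
    _+_ _*_ : Carrier → Carrier → Carrier
    -_      : Carrier → Carrier
    0# 1#   : Carrier
    _≤_     : Carrier → Carrier → Set
    isCommutativeRing : IsCommutativeRing _≡_ _+_ _*_ -_ 0# 1#
    0≢1     : 0# ≢ 1#
    inverse : ∀ x → x ≢ 0# → Σ Carrier (λ y → x * y ≡ 1#)
    isDecTotalOrder : IsDecTotalOrder _≡_ _≤_
    +-mono-≤ : ∀ {x y} z → x ≤ y → x + z ≤ y + z
    *-nonneg : ∀ {x y} → 0# ≤ x → 0# ≤ y → 0# ≤ x * y

  open IsDecTotalOrder isDecTotalOrder public using (_≤?_)

  infixl 6 _-_
  _-_ : Carrier → Carrier → Carrier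
  x - y = x + (- y)

-- Combinatorial sum problems over an ordered field K.
-- Ground set 𝓔 = Fin n, solutions are subsets (Subset n), D is a finite
-- list of feasible solutions.

module CSP (K : OrderedField) where
  open OrderedField K

  data Ext : Set where
    fin : Carrier → Ext
    ∞   : Ext

  minExt : Ext → Ext → Ext
  minExt (fin x) (fin y) = if does (x ≤? y) then fin x else fin y
  minExt (fin x) ∞       = fin x
  minExt ∞       y       = y

  sumFin : ∀ {m} → (Fin m → Carrier) → Carrier
  sumFin {zero}  f = 0#
  sumFin {suc m} f = f zero + sumFin (λ i → f (suc i))

  cost : ∀ {n} → (Fin n → Carrier) → Subset n → Carrier
  cost c S = sumFin (λ x → if does (x ∈? S) then c x else 0#)

  costMin : ∀ {n} → (Fin n → Carrier) → List (Subset n) → Ext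
  costMin c []      = ∞
  costMin c (S ∷ M) = minExt (fin (cost c S)) (costMin c M)

  Dsim : ∀ {n} → List (Subset n) → Subset n → Subset n → List (Subset n)
  Dsim D A B =
    filter (λ S → ≡-dec BoolP._≟_ (A ∩ S) ⊥ ×-dec (B ⊆? S)) D

  Eset : ∀ {n k} → (Fin k → Fin n) → Subset n
  Eset e = tabulate (λ x → does (any? (λ i → e i ≟ᶠ x)))

  -- c_{-α,E}(x) = c(x) - Σ_{i : e_i = x} α_i   (= c(e_i) - α_i as E is
  -- given by an injective enumeration e)
  cMinus : ∀ {n k} → (Fin n → Carrier) → (Fin k → Fin n) → (Fin k → Carrier)
         → Fin n → Carrier
  cMinus c e α x = c x - sumFin (λ i → if does (e i ≟ᶠ x) then α i else 0#)

  cstar : ∀ {n} → (Fin n → Carrier) → List (Subset n) → Ext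
  cstar c D = costMin c D

  LPConstraint : Carrier → Ext → Ext → Set
  LPConstraint lhs (fin r) (fin s) = lhs ≤ r - s
  LPConstraint lhs (fin r) ∞       = ⊤
  LPConstraint lhs ∞       _       = ⊤

  ELLValue : ∀ {n k} → List (Subset n) → (Fin n → Carrier)
           → (Fin k → Fin n) → Carrier → Set
  ELLValue {n} {k} D c e v =
    Σ (Fin k → Carrier) λ α →
      (∀ i → 0# ≤ α i) × (v ≡ sumFin α) ×
      (∀ (F : Subset n) → F ⊆ Eset e →
        LPConstraint (sumFin (λ i → if does (e i ∈? F) then α i else 0#))
                     (costMin c (Dsim D (Eset e ─ F) F))
                     (cstar c D))

  TolValue : ∀ {n k} → List (Subset n) → (Fin n → Carrier)
           → (Fin k → Fin n) → Carrier → Set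
  TolValue {n} {k} D c e v =
    Σ (Fin k → Carrier) λ α →
      (∀ i → 0# ≤ α i) × (v ≡ sumFin α) ×
      (costMin (cMinus c e α) D ≡ cstar c D)

  IsMax : (Carrier → Set) → Ext → Set
  IsMax A (fin v) = A v × (∀ y → A y → y ≤ v)
  IsMax A ∞       = ∀ b → Σ Carrier (λ y → A y × ¬ (y ≤ b))

{-# OPTIONS --safe #-}
module Submission where

open import Defs
open import Data.Fin using (Fin)
open import Data.Fin.Subset using (Subset; ⊥)
open import Data.List using (List; [])
open import Data.List.Relation.Unary.All using (All)
open import Data.Product using (_×_)
open import Function.Definitions using (Injective)
open import Relation.Binary.PropositionalEquality using (_≡_; _≢_)

open import Level using (0ℓ)
open import Algebra.Bundles using (CommutativeRing)
import Algebra.Properties.CommutativeMonoid.Sum as CommutativeMonoidSum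
import Algebra.Properties.Group as GroupProperties
open import Data.Bool using (true; false; if_then_else_)
import Data.Bool.Properties as Bool
open import Data.Empty using (⊥-elim)
open import Data.Fin using (zero; suc)
open import Data.Fin.Properties using (any?) renaming (_≟_ to _≟ᶠ_)
open import Data.Fin.Subset using (_∈_; _∉_; _∩_; _─_; inside; outside) renaming (_⊆_ to _⊆ˢ_)
open import Data.Fin.Subset.Properties
  using (_∈?_; _⊆?_; Empty-unique; ∉⊥; x∈p∩q⁺; x∈p∩q⁻; p∩q⊆p; p∩q⊆q; p─q⊆p; x∈p∧x∉q⇒x∈p─q)
open import Data.List using (_∷_)
open import Data.List.Membership.Propositional using () renaming (_∈_ to _∈ₗ_)
open import Data.List.Membership.Propositional.Properties using (∈-filter⁺; ∈-filter⁻)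
open import Data.List.Relation.Unary.Any using (here; there)
open import Data.Nat using (ℕ)
open import Data.Product using (∃; _,_; proj₂; swap)
open import Data.Sum using (_⊎_; inj₁; inj₂)
open import Data.Unit using (tt)
open import Data.Vec using (_∷_) renaming (here to hereᵛ; there to thereᵛ)
open import Data.Vec.Properties using (≡-dec; lookup∘tabulate; lookup⇒[]=)
open import Function using (_⇔_; mk⇔; Equivalence)
open import Relation.Binary.Bundles using (DecTotalOrder)
import Relation.Binary.Properties.DecTotalOrder as DecTotalOrderProperties
open import Relation.Binary.PropositionalEquality
  using (refl; sym; trans; cong; cong₂; subst; subst₂; module ≡-Reasoning)
open import Relation.Nullary using (does; yes; no; contradiction)
open import Relation.Nullary.Decidable using (does-⇔; dec-true; _×-dec_)
open import Relation.Unary using (Pred; Decidable; _≐_)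

-- Write α(S) = Σ_{e_i ∈ S} α_i.  Lowering the costs by α lowers the cost of
-- every solution by exactly α(S).  For α ≥ 0 the c-optimal solution still
-- costs at most c* afterwards, so the lowered optimum is c* iff
-- c* ≤ f_c(S) − α(S), i.e. α(S) ≤ f_c(S) − c*, for every S ∈ D.  As α(S)
-- only depends on the trace S ∩ E, and D_∼(E∖F;F) consists of the solutions
-- with trace F, these inequalities are exactly the constraints of (ELL).
-- Both sets of values Σ α_i therefore coincide, and so do their maxima.

x∈p─q⇒x∉q : ∀ {n} {x : Fin n} (p q : Subset n) → x ∈ p ─ q → x ∉ q
x∈p─q⇒x∉q (inside ∷ p) (outside ∷ q) hereᵛ ()
x∈p─q⇒x∉q (_ ∷ p) (_ ∷ q) (thereᵛ x∈p─q) (thereᵛ x∈q) = x∈p─q⇒x∉q p q x∈p─q x∈q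

module _ (K : OrderedField) where
  open OrderedField K
  open CSP K

  decTotalOrder : DecTotalOrder 0ℓ 0ℓ 0ℓ
  decTotalOrder = record
    { Carrier = Carrier ; _≈_ = _≡_ ; _≤_ = _≤_ ; isDecTotalOrder = isDecTotalOrder }

  open DecTotalOrder decTotalOrder using (antisym) renaming (refl to ≤-refl; trans to ≤-trans)
  open DecTotalOrderProperties decTotalOrder using (≰⇒≥)

  commutativeRing : CommutativeRing 0ℓ 0ℓ
  commutativeRing = record
    { Carrier = Carrier ; _≈_ = _≡_ ; _+_ = _+_ ; _*_ = _*_ ; -_ = -_
    ; 0# = 0# ; 1# = 1# ; isCommutativeRing = isCommutativeRing }

  open CommutativeRing commutativeRing
    using (+-identityˡ; +-identityʳ; +-comm; +-commutativeMonoid; +-group)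
  open GroupProperties +-group using (//-rightDividesˡ; //-rightDividesʳ)
  open CommutativeMonoidSum +-commutativeMonoid
    using (sum; sum-cong-≗; sum-replicate-zero; ∑-distrib-+; ∑-comm)
  open ≡-Reasoning

  x≤y-z⇒x+z≤y : ∀ {x y z} → x ≤ y - z → x + z ≤ y
  x≤y-z⇒x+z≤y {y = y} {z} h = subst (_ ≤_) (//-rightDividesˡ z y) (+-mono-≤ z h)

  x+z≤y⇒x≤y-z : ∀ {x y z} → x + z ≤ y → x ≤ y - z
  x+z≤y⇒x≤y-z {x} {z = z} h = subst (_≤ _) (//-rightDividesʳ z x) (+-mono-≤ (- z) h)

  x≤y⇔z≤y+z-x : ∀ {x y z} → x ≤ y ⇔ z ≤ (y + z) - x
  x≤y⇔z≤y+z-x {x} {y} {z} = mk⇔ to from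
    where
    to : x ≤ y → z ≤ (y + z) - x
    to x≤y = x+z≤y⇒x≤y-z (subst (_≤ y + z) (+-comm x z) (+-mono-≤ z x≤y))

    from : z ≤ (y + z) - x → x ≤ y
    from h = subst (x ≤_) (//-rightDividesʳ z y)
               (x+z≤y⇒x≤y-z (subst (_≤ y + z) (+-comm z x) (x≤y-z⇒x+z≤y h)))

  x≤x+y : ∀ x {y} → 0# ≤ y → x ≤ x + y
  x≤x+y x {y} 0≤y = subst₂ _≤_ (+-identityˡ x) (+-comm y x) (+-mono-≤ x 0≤y)

  sumFin≡sum : ∀ {m} (f : Fin m → Carrier) → sumFin f ≡ sum f
  sumFin≡sum {ℕ.zero}  f = refl
  sumFin≡sum {ℕ.suc m} f = cong (f zero +_) (sumFin≡sum (λ i → f (suc i)))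

  sumFin-cong : ∀ {m} {f g : Fin m → Carrier} → (∀ i → f i ≡ g i) → sumFin f ≡ sumFin g
  sumFin-cong {f = f} {g} f≗g = trans (sumFin≡sum f) (trans (sum-cong-≗ f≗g) (sym (sumFin≡sum g)))

  sumFin-nonneg : ∀ {m} (f : Fin m → Carrier) → (∀ i → 0# ≤ f i) → 0# ≤ sumFin f
  sumFin-nonneg {ℕ.zero}  f f≥0 = ≤-refl
  sumFin-nonneg {ℕ.suc m} f f≥0 =
    ≤-trans (f≥0 zero) (x≤x+y (f zero) (sumFin-nonneg (λ i → f (suc i)) (λ i → f≥0 (suc i))))

  sum-δ : ∀ {m} (y : Fin m) (f : Fin m → Carrier) →
          sum (λ x → if does (y ≟ᶠ x) then f x else 0#) ≡ f y
  sum-δ {ℕ.suc m} zero f = trans (cong (f zero +_) (sum-replicate-zero m)) (+-identityʳ (f zero))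
  sum-δ (suc y)   f = trans (+-identityˡ _) (sum-δ y (λ x → f (suc x)))

  if-+ : ∀ b x y → (if b then x + y else 0#) ≡ (if b then x else 0#) + (if b then y else 0#)
  if-+ true  x y = refl
  if-+ false x y = sym (+-identityʳ 0#)

  if-sum : ∀ {m} b (f : Fin m → Carrier) →
           (if b then sum f else 0#) ≡ sum (λ i → if b then f i else 0#)
  if-sum     true  f = refl
  if-sum {m} false f = sym (sum-replicate-zero m)

  if-comm : ∀ b b′ x →
            (if b then (if b′ then x else 0#) else 0#) ≡ (if b′ then (if b then x else 0#) else 0#)
  if-comm true  b′    x = refl
  if-comm false true  x = refl
  if-comm false false x = refl

  infixl 5 _↾_
  _↾_ : ∀ {n} → (Fin n → Carrier) → Subset n → Fin n → Carrier
  (f ↾ S) x = if does (x ∈? S) then f x else 0#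

  cost-cong : ∀ {n} {f g : Fin n → Carrier} → (∀ x → f x ≡ g x) → ∀ S → cost f S ≡ cost g S
  cost-cong f≗g S = sumFin-cong (λ x → cong (λ y → if does (x ∈? S) then y else 0#) (f≗g x))

  cost-+ : ∀ {n} (f g : Fin n → Carrier) S → cost (λ x → f x + g x) S ≡ cost f S + cost g S
  cost-+ f g S = begin
    cost (λ x → f x + g x) S                   ≡⟨ sumFin≡sum ((λ x → f x + g x) ↾ S) ⟩
    sum ((λ x → f x + g x) ↾ S)                ≡⟨ sum-cong-≗ (λ x → if-+ (does (x ∈? S)) (f x) (g x)) ⟩
    sum (λ x → (f ↾ S) x + (g ↾ S) x)          ≡⟨ ∑-distrib-+ (f ↾ S) (g ↾ S) ⟩
    sum (f ↾ S) + sum (g ↾ S)                  ≡⟨ sym (cong₂ _+_ (sumFin≡sum (f ↾ S)) (sumFin≡sum (g ↾ S))) ⟩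
    cost f S + cost g S                        ∎

  decrease : ∀ {n k} → (Fin k → Fin n) → (Fin k → Carrier) → Fin n → Carrier
  decrease e α x = sumFin (λ i → if does (e i ≟ᶠ x) then α i else 0#)

  reduction : ∀ {n k} → (Fin k → Fin n) → (Fin k → Carrier) → Subset n → Carrier
  reduction e α S = sumFin (λ i → if does (e i ∈? S) then α i else 0#)

  cost-decrease : ∀ {n k} (e : Fin k → Fin n) α S → cost (decrease e α) S ≡ reduction e α S
  cost-decrease {n} {k} e α S = begin
    cost (decrease e α) S                      ≡⟨ sumFin≡sum (decrease e α ↾ S) ⟩
    sum (decrease e α ↾ S)                     ≡⟨ sum-cong-≗ pushIn ⟩
    sum (λ x → sum (λ i → (δ i ↾ S) x))        ≡⟨ ∑-comm (λ x i → (δ i ↾ S) x) ⟩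
    sum (λ i → sum (δ i ↾ S))                  ≡⟨ sum-cong-≗ collapse ⟩
    sum (λ i → if does (e i ∈? S) then α i else 0#)
      ≡⟨ sym (sumFin≡sum (λ i → if does (e i ∈? S) then α i else 0#)) ⟩
    reduction e α S                            ∎
    where
    δ : Fin k → Fin n → Carrier
    δ i x = if does (e i ≟ᶠ x) then α i else 0#

    pushIn : ∀ x → (decrease e α ↾ S) x ≡ sum (λ i → (δ i ↾ S) x)
    pushIn x = trans (cong (λ y → if does (x ∈? S) then y else 0#) (sumFin≡sum (λ i → δ i x)))
                     (if-sum (does (x ∈? S)) (λ i → δ i x))

    collapse : ∀ i → sum (δ i ↾ S) ≡ (if does (e i ∈? S) then α i else 0#)
    collapse i = trans (sum-cong-≗ (λ x → if-comm (does (x ∈? S)) (does (e i ≟ᶠ x)) (α i)))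
                       (sum-δ (e i) (λ x → if does (x ∈? S) then α i else 0#))

  cost≡cost-cMinus+reduction : ∀ {n k} (c : Fin n → Carrier) (e : Fin k → Fin n) α S →
                               cost c S ≡ cost (cMinus c e α) S + reduction e α S
  cost≡cost-cMinus+reduction c e α S = begin
    cost c S
      ≡⟨ cost-cong (λ x → sym (//-rightDividesˡ (decrease e α x) (c x))) S ⟩
    cost (λ x → cMinus c e α x + decrease e α x) S
      ≡⟨ cost-+ (cMinus c e α) (decrease e α) S ⟩
    cost (cMinus c e α) S + cost (decrease e α) S
      ≡⟨ cong (cost (cMinus c e α) S +_) (cost-decrease e α S) ⟩
    cost (cMinus c e α) S + reduction e α S ∎

  ≤-cost-cMinus⇔reduction≤ : ∀ {n k} (c : Fin n → Carrier) (e : Fin k → Fin n) α S m →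
    m ≤ cost (cMinus c e α) S ⇔ reduction e α S ≤ cost c S - m
  ≤-cost-cMinus⇔reduction≤ c e α S m =
    subst (λ t → m ≤ cost (cMinus c e α) S ⇔ reduction e α S ≤ t - m)
          (sym (cost≡cost-cMinus+reduction c e α S)) x≤y⇔z≤y+z-x

  reduction-nonneg : ∀ {n k} (e : Fin k → Fin n) {α} → (∀ i → 0# ≤ α i) → ∀ S → 0# ≤ reduction e α S
  reduction-nonneg e {α} α≥0 S = sumFin-nonneg _ nonneg
    where
    nonneg : ∀ i → 0# ≤ (if does (e i ∈? S) then α i else 0#)
    nonneg i with does (e i ∈? S)
    ... | true  = α≥0 i
    ... | false = ≤-refl

  reduction-cong : ∀ {n k} (e : Fin k → Fin n) α {F S} → (∀ i → e i ∈ F ⇔ e i ∈ S) →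
                   reduction e α F ≡ reduction e α S
  reduction-cong e α {F} {S} agree =
    sumFin-cong (λ i → cong (λ b → if b then α i else 0#) (does-⇔ (agree i) (e i ∈? F) (e i ∈? S)))

  minExt-finite : ∀ x y → ∃ λ z → minExt (fin x) y ≡ fin z
  minExt-finite x (fin y) with does (x ≤? y)
  ... | true  = x , refl
  ... | false = y , refl
  minExt-finite x ∞ = x , refl

  minExt-≤ˡ : ∀ x y {z} → minExt (fin x) y ≡ fin z → z ≤ x
  minExt-≤ˡ x (fin y) eq with x ≤? y
  minExt-≤ˡ x (fin y) refl | yes _   = ≤-refl
  minExt-≤ˡ x (fin y) refl | no x≰y = ≰⇒≥ x≰y
  minExt-≤ˡ x ∞ refl = ≤-refl

  minExt-≤ʳ : ∀ x y {z} → minExt (fin x) (fin y) ≡ fin z → z ≤ y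
  minExt-≤ʳ x y eq with x ≤? y
  minExt-≤ʳ x y refl | yes x≤y = x≤y
  minExt-≤ʳ x y refl | no _    = ≤-refl

  minExt-sel : ∀ x y {z} → minExt (fin x) y ≡ fin z → x ≡ z ⊎ y ≡ fin z
  minExt-sel x (fin y) eq with does (x ≤? y)
  minExt-sel x (fin y) refl | true  = inj₁ refl
  minExt-sel x (fin y) eq   | false = inj₂ eq
  minExt-sel x ∞ refl = inj₁ refl

  CostLowerBound : ∀ {n} → (Fin n → Carrier) → List (Subset n) → Carrier → Set
  CostLowerBound c M m = ∀ {S} → S ∈ₗ M → m ≤ cost c S

  costMin-finite : ∀ {n} (c : Fin n → Carrier) {M S} → S ∈ₗ M → ∃ λ r → costMin c M ≡ fin r
  costMin-finite c {S′ ∷ M} _ = minExt-finite (cost c S′) (costMin c M)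

  costMin-lowerBound : ∀ {n} (c : Fin n → Carrier) {M m} → costMin c M ≡ fin m → CostLowerBound c M m
  costMin-lowerBound c {S′ ∷ M} eq (here refl) = minExt-≤ˡ (cost c S′) (costMin c M) eq
  costMin-lowerBound c {S′ ∷ M} eq (there S∈M) with costMin-finite c S∈M
  ... | r , eqʳ = ≤-trans (minExt-≤ʳ (cost c S′) r (subst (λ y → minExt (fin (cost c S′)) y ≡ fin _) eqʳ eq))
                          (costMin-lowerBound c eqʳ S∈M)

  costMin-attained : ∀ {n} (c : Fin n → Carrier) {M m} → costMin c M ≡ fin m →
                     ∃ λ S → S ∈ₗ M × cost c S ≡ m
  costMin-attained c {S′ ∷ M} eq with minExt-sel (cost c S′) (costMin c M) eq
  ... | inj₁ cost≡m = S′ , here refl , cost≡m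
  ... | inj₂ eqᴹ with costMin-attained c eqᴹ
  ...   | S , S∈M , cost≡m = S , there S∈M , cost≡m

  costMin≡lowerBound : ∀ {n} (c : Fin n → Carrier) {M m S} → CostLowerBound c M m →
                       S ∈ₗ M → cost c S ≤ m → costMin c M ≡ fin m
  costMin≡lowerBound c {m = m} lb S∈M cost≤m with costMin-finite c S∈M
  ... | r , eq with costMin-attained c eq
  ...   | S′ , S′∈M , cost≡r =
    trans eq (cong fin (antisym (≤-trans (costMin-lowerBound c eq S∈M) cost≤m)
                                (subst (m ≤_) cost≡r (lb S′∈M))))

  e∈Eset : ∀ {n k} (e : Fin k → Fin n) i → e i ∈ Eset e
  e∈Eset e i = lookup⇒[]= (e i) (Eset e)
    (trans (lookup∘tabulate _ (e i)) (dec-true (any? (λ j → e j ≟ᶠ e i)) (i , refl)))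

  module _ {n} (D : List (Subset n)) (A B : Subset n) where
    private
      keep? : Decidable (λ S → A ∩ S ≡ ⊥ × B ⊆ˢ S)
      keep? S = ≡-dec Bool._≟_ (A ∩ S) ⊥ ×-dec (B ⊆? S)

    ∈-Dsim⁺ : ∀ {S} → S ∈ₗ D → A ∩ S ≡ ⊥ → B ⊆ˢ S → S ∈ₗ Dsim D A B
    ∈-Dsim⁺ S∈D disjoint B⊆S = ∈-filter⁺ keep? S∈D (disjoint , B⊆S)

    ∈-Dsim⁻ : ∀ {S} → S ∈ₗ Dsim D A B → S ∈ₗ D × A ∩ S ≡ ⊥ × B ⊆ˢ S
    ∈-Dsim⁻ = ∈-filter⁻ keep?

  module _ {n k} (e : Fin k → Fin n) where
    private
      E : Subset n
      E = Eset e

    ∩-trace : ∀ S i → e i ∈ S ∩ E ⇔ e i ∈ S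
    ∩-trace S i = mk⇔ (p∩q⊆p S E) (λ eᵢ∈S → x∈p∩q⁺ (eᵢ∈S , e∈Eset e i))

    ∩-trace-disjoint : ∀ S → (E ─ S ∩ E) ∩ S ≡ ⊥
    ∩-trace-disjoint S = Empty-unique λ (x , x∈) →
      let x∈E─S∩E , x∈S = x∈p∩q⁻ (E ─ S ∩ E) S x∈
      in x∈p─q⇒x∉q E (S ∩ E) x∈E─S∩E (x∈p∩q⁺ (x∈S , p─q⊆p E (S ∩ E) x∈E─S∩E))

    Dsim-trace : ∀ {F S} → (E ─ F) ∩ S ≡ ⊥ → F ⊆ˢ S → ∀ i → e i ∈ F ⇔ e i ∈ S
    Dsim-trace {F} {S} disjoint F⊆S i = mk⇔ F⊆S eᵢ∈F
      where
      eᵢ∈F : e i ∈ S → e i ∈ F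
      eᵢ∈F eᵢ∈S with e i ∈? F
      ... | yes eᵢ∈F = eᵢ∈F
      ... | no  eᵢ∉F = ⊥-elim (∉⊥ (subst (e i ∈_) disjoint
                                     (x∈p∩q⁺ (x∈p∧x∉q⇒x∈p─q (e∈Eset e i) eᵢ∉F , eᵢ∈S))))

  LPConstraint-fin⁺ : ∀ {l X s m} → s ≡ fin m → (∀ {r} → X ≡ fin r → l ≤ r - m) → LPConstraint l X s
  LPConstraint-fin⁺ {X = fin r} refl h = h refl
  LPConstraint-fin⁺ {X = ∞}     refl h = tt

  LPConstraint-fin⁻ : ∀ {l X s m r} → s ≡ fin m → LPConstraint l X s → X ≡ fin r → l ≤ r - m
  LPConstraint-fin⁻ refl h refl = h

  IsMax-resp-≐ : ∀ {P Q : Pred Carrier 0ℓ} → P ≐ Q → ∀ v → IsMax P v → IsMax Q v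
  IsMax-resp-≐ (P⊆Q , Q⊆P) (fin v) (Pv , maximal) = P⊆Q Pv , λ y Qy → maximal y (Q⊆P Qy)
  IsMax-resp-≐ (P⊆Q , _)   ∞       unbounded b      =
    let y , Py , y≰b = unbounded b in y , P⊆Q Py , y≰b

  module _ {n k} (D : List (Subset n)) (c : Fin n → Carrier) (e : Fin k → Fin n)
           {m} (c*≡m : cstar c D ≡ fin m) where
    private
      E : Subset n
      E = Eset e

      optimumWithTrace : Subset n → Ext
      optimumWithTrace F = costMin c (Dsim D (E ─ F) F)

    LPFeasible : (Fin k → Carrier) → Set
    LPFeasible α = ∀ F → F ⊆ˢ E → LPConstraint (reduction e α F) (optimumWithTrace F) (cstar c D)

    lpFeasible⇒lowerBound : ∀ {α} → LPFeasible α → CostLowerBound (cMinus c e α) D m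
    lpFeasible⇒lowerBound {α} feasible {S} S∈D =
      let r , costMin≡r = costMin-finite c S∈Dsim
          reduction≤r-m = LPConstraint-fin⁻ c*≡m (feasible F (p∩q⊆q S E)) costMin≡r
          r≤cost = costMin-lowerBound c costMin≡r S∈Dsim
      in Equivalence.from (≤-cost-cMinus⇔reduction≤ c e α S m)
           (subst (_≤ cost c S - m) (reduction-cong e α (∩-trace e S))
                  (≤-trans reduction≤r-m (+-mono-≤ (- m) r≤cost)))
      where
      F : Subset n
      F = S ∩ E

      S∈Dsim : S ∈ₗ Dsim D (E ─ F) F
      S∈Dsim = ∈-Dsim⁺ D (E ─ F) F S∈D (∩-trace-disjoint e S) (p∩q⊆p S E)

    lowerBound⇒lpFeasible : ∀ {α} → CostLowerBound (cMinus c e α) D m → LPFeasible α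
    lowerBound⇒lpFeasible {α} lowerBound F _ = LPConstraint-fin⁺ c*≡m bound
      where
      bound : ∀ {r} → optimumWithTrace F ≡ fin r → reduction e α F ≤ r - m
      bound costMin≡r =
        let S , S∈Dsim , cost≡r = costMin-attained c costMin≡r
            S∈D , disjoint , F⊆S = ∈-Dsim⁻ D (E ─ F) F S∈Dsim
        in subst₂ (λ a b → a ≤ b - m) (sym (reduction-cong e α (Dsim-trace e disjoint F⊆S))) cost≡r
             (Equivalence.to (≤-cost-cMinus⇔reduction≤ c e α S m) (lowerBound S∈D))

    tolerance⇒lowerBound : ∀ {α} → costMin (cMinus c e α) D ≡ cstar c D →
                           CostLowerBound (cMinus c e α) D m
    tolerance⇒lowerBound {α} tolerant = costMin-lowerBound (cMinus c e α) (trans tolerant c*≡m)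

    lowerBound⇒tolerance : ∀ {α} → (∀ i → 0# ≤ α i) → CostLowerBound (cMinus c e α) D m →
                           costMin (cMinus c e α) D ≡ cstar c D
    lowerBound⇒tolerance {α} α≥0 lowerBound =
      let S , S∈D , cost≡m = costMin-attained c c*≡m
          cost′≤m = subst (cost (cMinus c e α) S ≤_)
                          (trans (sym (cost≡cost-cMinus+reduction c e α S)) cost≡m)
                          (x≤x+y _ (reduction-nonneg e α≥0 S))
      in trans (costMin≡lowerBound (cMinus c e α) lowerBound S∈D cost′≤m) (sym c*≡m)

    ELLValue≐TolValue : ELLValue D c e ≐ TolValue D c e
    ELLValue≐TolValue =
      (λ (α , α≥0 , v≡Σα , feasible) →
         α , α≥0 , v≡Σα , lowerBound⇒tolerance α≥0 (lpFeasible⇒lowerBound feasible)) ,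
      (λ (α , α≥0 , v≡Σα , tolerant) →
         α , α≥0 , v≡Σα , lowerBound⇒lpFeasible (tolerance⇒lowerBound tolerant))

theorem10 : (K : OrderedField) → let open OrderedField K in let open CSP K in
    ∀ {n k} (D : List (Subset n)) → All (λ S → S ≢ ⊥) D → D ≢ [] →
    (c : Fin n → Carrier) → (e : Fin k → Fin n) → Injective _≡_ _≡_ e →
    (v : Ext) →
    (IsMax (ELLValue D c e) v → IsMax (TolValue D c e) v) ×
    (IsMax (TolValue D c e) v → IsMax (ELLValue D c e) v)
theorem10 K []      _ []≢[] c e _ v = contradiction refl []≢[]
theorem10 K (S ∷ D) _ _     c e _ v =
  IsMax-resp-≐ K ELL≐Tol v , IsMax-resp-≐ K (swap ELL≐Tol) v
  where
  open CSP K using (ELLValue; TolValue)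
  ELL≐Tol : ELLValue (S ∷ D) c e ≐ TolValue (S ∷ D) c e
  ELL≐Tol = ELLValue≐TolValue K (S ∷ D) c e (proj₂ (costMin-finite K c {S ∷ D} (here refl)))
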